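{- For every integer $n \ge 7$, with $P_{n,H}(k) := P(|S-S| = k)$ where $S$ is a uniformly random subset of $[n]=\{0,\dots,n-1\}$, we have $P_{n,H}(7) > P_{n,H}(9) < P_{n,H}(11)$ (that is, the sequence $(P_{n,H}(k))_k$ has a divot at $9$: $P_{n,H}(9)$ is smaller than its nearest nonzero neighbour on each side).
   Context: For a positive integer $n$, $[n] := \{0,1,\dots,n-1\}$, and $S$ is chosen uniformly at random among all $2^n$ subsets of $[n]$. The difference set is $S-S := \{x-y : x,y \in S\}$. Note $|S-S|$ is always $0$ or odd, so $P_{n,H}(k)=0$ for even $k>0$. -}

module Defs where

open import Data.Nat using (ℕ; zero; suc; _^_; _∸_)
open import Data.Integer as ℤ using (ℤ; +_; _-_)
open import Data.Fin using (Fin; toℕ)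
open import Data.Fin.Subset using (Subset; _∈_; inside; outside)
open import Data.Fin.Subset.Properties using (_∈?_)
open import Data.Vec using (Vec; []; _∷_)
open import Data.List using (List; []; _∷_; map; _++_; filter; length; allFin; upTo)
open import Data.List.Relation.Unary.Any using (any?)
open import Data.Product using (∃₂; _×_; _,_)
open import Data.Rational using (ℚ; _/_)
open import Relation.Nullary using (Dec; yes; no)
open import Relation.Nullary.Decidable using (_×-dec_)
open import Relation.Binary.PropositionalEquality using (_≡_)
import Data.Integer.Properties as ℤP

allSubsets : (n : ℕ) → List (Subset n)
allSubsets zero    = [] ∷ []
allSubsets (suc n) = map (outside ∷_) (allSubsets n) ++ map (inside ∷_) (allSubsets n)

InDiff : {n : ℕ} → Subset n → ℤ → Set
InDiff {n} S d = ∃₂ λ (x y : Fin n) → x ∈ S × y ∈ S × ((+ toℕ x) - (+ toℕ y) ≡ d)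

InDiff? : {n : ℕ} (S : Subset n) (d : ℤ) → Dec (InDiff S d)
InDiff? {n} S d =
  any? (λ x → any? (λ y → (x ∈? S) ×-dec ((y ∈? S) ×-dec ((+ toℕ x) - (+ toℕ y) ℤ.≟ d)))
         (allFin n))
       (allFin n)
  |> convert
  where
  open import Data.List.Membership.Propositional using ()
  open import Data.List.Relation.Unary.Any using (Any; here; there; satisfied)
  open import Function using (_|>_)
  convert : _ → Dec (InDiff S d)
  convert (yes p) with satisfied p
  ... | x , q with satisfied q
  ... | y , (a , b , c) = yes (x , y , a , b , c)
  convert (no ¬p) = no λ { (x , y , a , b , c) →
    ¬p (anyAll x (anyAll y (a , b , c))) }
    where
    open import Data.List.Membership.Propositional.Properties using (∈-allFin)
    open import Data.List.Relation.Unary.Any.Properties using ()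
    open import Data.List.Relation.Unary.Any using (Any)
    anyAll : ∀ {P : Fin n → Set} (z : Fin n) → P z → Any P (allFin n)
    anyAll {P} z pz = Data.List.Relation.Unary.Any.map (λ { _≡_.refl → pz }) (∈-allFin z)
      where import Data.List.Relation.Unary.Any

-- All candidate differences: -(n-1), …, n-1 (every element of S - S lies here).
candidates : ℕ → List ℤ
candidates n = map (λ i → + i - + (n ∸ 1)) (upTo ((2 Data.Nat.* n) ∸ 1))
  where import Data.Nat

diffSize : {n : ℕ} → Subset n → ℕ
diffSize {n} S = length (filter (InDiff? S) (candidates n))

count : ℕ → ℕ → ℕ
count n k = length (filter (λ S → diffSize S Data.Nat.≟ k) (allSubsets n))
  where import Data.Nat

P : ℕ → ℕ → ℚ
P n k = _/_ (+ count n k) (2 ^ n) {{Data.Nat.>-nonZero (Data.Nat.Properties.m^n>0 2 n)}}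
  where
  import Data.Nat
  import Data.Nat.Properties

module Submission where

-- Translating a set does not change its difference set, so the subsets of [n+1] are those of
-- [n] shifted by one together with those containing 0, and
-- count (n+1) k = count n k + #{S ⊆ [n+1] : 0 ∈ S, |S − S| = k}.
-- A set containing 0 is described by its sequence of gaps, and |S − S| = 2d + 1 where d is the
-- number of distinct sums of runs of consecutive gaps. The sets with d = 4 have gaps (p,q,p)
-- with q ≠ p, (t,t,2t), (2t,t,t) or (t,t,t,t); explicit injective recodings send these to gap
-- sequences with d = 3 and with d = 5, without raising the diameter above max(diameter, 5).
-- So for n ≥ 5 the sets containing 0 with nine differences are at most as many as those with
-- seven and at most as many as those with eleven, and the strict inequalities computed at
-- n = 7 propagate to every n ≥ 7.

open import Defs
open import Data.Nat using (ℕ; _≥_)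
open import Data.Rational using (_<_; _>_)
open import Data.Product using (_×_)

open import Data.Bool using (true)
open import Data.Empty using (⊥-elim)
open import Data.Fin as Fin using (Fin; toℕ; fromℕ<)
import Data.Fin.Properties as FinP
open import Data.Fin.Subset using (Subset; inside; outside) renaming (_∈_ to _∈ₛ_)
open import Data.Fin.Subset.Properties using (⊆-antisym)
open import Data.Integer as ℤ using (ℤ; +_; -[1+_]; _⊖_)
import Data.Integer.Properties as ℤP
open import Data.List using (List; []; _∷_; _++_; map; filter; length; upTo; deduplicate)
open import Data.List.Membership.Propositional using (_∈_; _─_)
open import Data.List.Membership.Propositional.Properties
open import Data.List.Properties
  using (length-removeAt′; length-++; length-map; filter-++; filter-accept; filter-reject)
open import Data.List.Relation.Binary.Subset.Propositional using (_⊆_)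
open import Data.List.Relation.Binary.Sublist.Propositional as Sublist
  using ([]; _∷_; _∷ʳ_; minimum) renaming (_⊆_ to _⊑_)
open import Data.List.Relation.Unary.All as All using (All; []; _∷_)
import Data.List.Relation.Unary.All.Properties as AllP
open import Data.List.Relation.Unary.AllPairs using ([]; _∷_)
open import Data.List.Relation.Unary.Any using (here; there; index)
open import Data.List.Relation.Unary.Unique.Propositional using (Unique)
import Data.List.Relation.Unary.Unique.Propositional.Properties as UniqueP
open import Data.Nat as ℕ using (zero; suc; _+_; _*_; _^_; _∸_; _⊔_; _≤_; z≤n; s≤s; _≟_)
import Data.Nat.Properties as ℕP
open import Data.Nat.ListAction using (sum)
open import Data.Nat.Tactic.RingSolver using (solve-∀)
open import Data.Product using (∃₂; ∃-syntax; _,_; proj₁; proj₂)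
import Data.Rational as ℚ
import Data.Rational.Properties as ℚP
import Data.Rational.Unnormalised as ℚᵘ
import Data.Rational.Unnormalised.Properties as ℚᵘP
open import Data.Sum using (_⊎_; inj₁; inj₂)
open import Data.Vec using ([]; _∷_; here; there; tabulate)
open import Data.Vec.Properties using ([]=⇒lookup; lookup⇒[]=; lookup∘tabulate; ∷-injectiveʳ)
open import Function using (_∘_)
open import Relation.Binary.PropositionalEquality
  using (_≡_; _≢_; refl; sym; trans; cong; cong₂; subst; subst₂; module ≡-Reasoning)
open import Relation.Nullary using (¬_; does; yes; no)
open import Relation.Nullary.Decidable using (dec-true; from-yes)
open import Relation.Unary using (Decidable)

open import Algebra.Properties.AbelianGroup ℤP.+-0-abelianGroup using (∙-cancelʳ)
open import Data.List.Membership.DecPropositional _≟_ using (_∈?_)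
open import Data.List.Relation.Unary.Unique.DecPropositional.Properties _≟_ using (deduplicate-!)

private variable
  A B : Set
  n : ℕ

∈-─⁺ : {x y : A} {xs : List A} (x∈xs : x ∈ xs) → y ∈ xs → y ≢ x → y ∈ xs ─ x∈xs
∈-─⁺ (here refl) (here refl) y≢x = ⊥-elim (y≢x refl)
∈-─⁺ (here refl) (there y∈xs) _  = y∈xs
∈-─⁺ (there _)   (here refl)  _  = here refl
∈-─⁺ (there x∈xs) (there y∈xs) y≢x = there (∈-─⁺ x∈xs y∈xs y≢x)

length-≤-injection : {xs : List A} {ys : List B} → Unique xs →
  (f : ∀ {x} → x ∈ xs → B) → (∀ {x} (x∈xs : x ∈ xs) → f x∈xs ∈ ys) →
  (∀ {x y} (x∈xs : x ∈ xs) (y∈xs : y ∈ xs) → f x∈xs ≡ f y∈xs → x ≡ y) →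
  length xs ≤ length ys
length-≤-injection {xs = []}     _            _ _    _     = z≤n
length-≤-injection {xs = x ∷ xs} {ys} (x∉xs ∷ xs!) f f∈ys f-inj =
  subst (suc (length xs) ≤_) (sym (length-removeAt′ ys (index fx∈ys)))
    (s≤s (length-≤-injection xs! (f ∘ there) f∈ys─fx
           (λ p q → f-inj (there p) (there q))))
  where
  fx∈ys = f∈ys (here refl)
  f∈ys─fx : ∀ {y} (y∈xs : y ∈ xs) → f (there y∈xs) ∈ ys ─ fx∈ys
  f∈ys─fx y∈xs = ∈-─⁺ fx∈ys (f∈ys (there y∈xs))
    (λ fy≡fx → All.lookup x∉xs y∈xs (sym (f-inj (there y∈xs) (here refl) fy≡fx)))

length-≤-⊆ : {xs ys : List A} → Unique xs → xs ⊆ ys → length xs ≤ length ys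
length-≤-⊆ xs! xs⊆ys = length-≤-injection xs! (λ {x} _ → x) xs⊆ys (λ _ _ x≡y → x≡y)

length-≡-⊆⊇ : {xs ys : List A} → Unique xs → Unique ys → xs ⊆ ys → ys ⊆ xs →
  length xs ≡ length ys
length-≡-⊆⊇ xs! ys! xs⊆ys ys⊆xs = ℕP.≤-antisym (length-≤-⊆ xs! xs⊆ys) (length-≤-⊆ ys! ys⊆xs)

length-filter-map : {P : B → Set} {Q : A → Set} (P? : Decidable P) (Q? : Decidable Q) (f : A → B) →
  (∀ {x} → P (f x) → Q x) → (∀ {x} → Q x → P (f x)) →
  ∀ xs → length (filter P? (map f xs)) ≡ length (filter Q? xs)
length-filter-map P? Q? f P⇒Q Q⇒P []       = refl
length-filter-map P? Q? f P⇒Q Q⇒P (x ∷ xs) with Q? x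
... | yes Qx = trans (cong length (filter-accept P? (Q⇒P Qx)))
  (cong suc (length-filter-map P? Q? f P⇒Q Q⇒P xs))
... | no ¬Qx = trans (cong length (filter-reject P? (¬Qx ∘ P⇒Q)))
  (length-filter-map P? Q? f P⇒Q Q⇒P xs)

-- Difference sets

InDiff-neg : {S : Subset n} {d : ℤ} → InDiff S d → InDiff S (ℤ.- d)
InDiff-neg (x , y , x∈S , y∈S , refl) = y , x , y∈S , x∈S , (begin
  + toℕ y ℤ.- + toℕ x      ≡⟨ ℤP.[+m]-[+n]≡m⊖n (toℕ y) (toℕ x) ⟩
  toℕ y ⊖ toℕ x            ≡⟨ ℤP.⊖-swap (toℕ y) (toℕ x) ⟩
  ℤ.- (toℕ x ⊖ toℕ y)      ≡⟨ cong ℤ.-_ (ℤP.[+m]-[+n]≡m⊖n (toℕ x) (toℕ y)) ⟨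
  ℤ.- (+ toℕ x ℤ.- + toℕ y) ∎)
  where open ≡-Reasoning

InDiff-zero : {S : Subset n} {x : Fin n} → x ∈ₛ S → InDiff S (+ 0)
InDiff-zero {x = x} x∈S = x , x , x∈S , x∈S , ℤP.+-inverseʳ (+ toℕ x)

n+o≡m⇒[+m]-[+n]≡+o : ∀ {m n o} → n + o ≡ m → + m ℤ.- + n ≡ + o
n+o≡m⇒[+m]-[+n]≡+o {n = n} {o} refl = begin
  + (n + o) ℤ.- + n     ≡⟨ ℤP.[+m]-[+n]≡m⊖n (n + o) n ⟩
  n + o ⊖ n             ≡⟨ cong (n + o ⊖_) (ℕP.+-identityʳ n) ⟨
  n + o ⊖ (n + 0)       ≡⟨ ℤP.+-cancelˡ-⊖ n o 0 ⟩
  + o                   ∎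
  where open ≡-Reasoning

[+m]-[+n]≡+o⇒n+o≡m : ∀ {m n o} → + m ℤ.- + n ≡ + o → n + o ≡ m
[+m]-[+n]≡+o⇒n+o≡m {m} {n} {o} m-n≡o = sym (ℤP.+-injective
  (∙-cancelʳ (ℤ.- + n) (+ m) (+ (n + o)) (trans m-n≡o (sym (n+o≡m⇒[+m]-[+n]≡+o {n = n} refl)))))

InDiff⇒∈candidates : {S : Subset n} {d : ℤ} → InDiff S d → d ∈ candidates n
InDiff⇒∈candidates {n = suc m} (x , y , _ , _ , refl) =
  subst (_∈ candidates (suc m)) shifted≡
    (∈-map⁺ (λ i → + i ℤ.- + m) (∈-upTo⁺ shifted<))
  where
  a = toℕ x
  b = toℕ y
  b≤m = ℕP.≤-pred (FinP.toℕ<n y)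
  shifted< : (m ∸ b) + a ℕ.< 2 * suc m ∸ 1
  shifted< = begin-strict
    (m ∸ b) + a   ≤⟨ ℕP.+-mono-≤ (ℕP.m∸n≤m m b) (ℕP.≤-pred (FinP.toℕ<n x)) ⟩
    m + m         <⟨ ℕP.+-monoʳ-< m (ℕP.n<1+n m) ⟩
    m + suc m     ≡⟨ cong (λ k → m + suc k) (ℕP.+-identityʳ m) ⟨
    2 * suc m ∸ 1 ∎
    where open ℕP.≤-Reasoning
  shifted≡ : + ((m ∸ b) + a) ℤ.- + m ≡ + a ℤ.- + b
  shifted≡ = begin
    + ((m ∸ b) + a) ℤ.- + m     ≡⟨ ℤP.[+m]-[+n]≡m⊖n _ m ⟩
    (m ∸ b) + a ⊖ m             ≡⟨ cong ((m ∸ b) + a ⊖_) (ℕP.m∸n+n≡m b≤m) ⟨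
    (m ∸ b) + a ⊖ ((m ∸ b) + b) ≡⟨ ℤP.+-cancelˡ-⊖ (m ∸ b) a b ⟩
    a ⊖ b                       ≡⟨ ℤP.[+m]-[+n]≡m⊖n a b ⟨
    + a ℤ.- + b                 ∎
    where open ≡-Reasoning

candidates-unique : ∀ n → Unique (candidates n)
candidates-unique n =
  UniqueP.map⁺ (λ eq → ℤP.+-injective (∙-cancelʳ (ℤ.- + (n ∸ 1)) _ _ eq)) (UniqueP.upTo⁺ _)

differences : (S : Subset n) → List ℤ
differences {n} S = filter (InDiff? S) (candidates n)

differences-unique : (S : Subset n) → Unique (differences S)
differences-unique {n} S = UniqueP.filter⁺ (InDiff? S) (candidates-unique n)

∈-differences⁺ : {S : Subset n} {d : ℤ} → InDiff S d → d ∈ differences S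
∈-differences⁺ {S = S} d∈S-S = ∈-filter⁺ (InDiff? S) (InDiff⇒∈candidates d∈S-S) d∈S-S

∈-differences⁻ : {S : Subset n} {d : ℤ} → d ∈ differences S → InDiff S d
∈-differences⁻ {n} {S} = proj₂ ∘ ∈-filter⁻ (InDiff? S) {xs = candidates n}

diffSize-cong : {m : ℕ} {S : Subset n} {T : Subset m} →
  (∀ {d} → InDiff S d → InDiff T d) → (∀ {d} → InDiff T d → InDiff S d) →
  diffSize S ≡ diffSize T
diffSize-cong {S = S} {T} S⊆T T⊆S = length-≡-⊆⊇ (differences-unique S) (differences-unique T)
  (∈-differences⁺ ∘ S⊆T ∘ ∈-differences⁻) (∈-differences⁺ ∘ T⊆S ∘ ∈-differences⁻)

diffSize-outside : (S : Subset n) → diffSize (outside ∷ S) ≡ diffSize S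
diffSize-outside S = diffSize-cong shiftDown shiftUp
  where
  suc-diff : ∀ a b → + suc a ℤ.- + suc b ≡ + a ℤ.- + b
  suc-diff a b = trans (ℤP.[+m]-[+n]≡m⊖n (suc a) (suc b))
    (trans (ℤP.[1+m]⊖[1+n]≡m⊖n a b) (sym (ℤP.[+m]-[+n]≡m⊖n a b)))
  shiftDown : ∀ {d} → InDiff (outside ∷ S) d → InDiff S d
  shiftDown (Fin.suc x , Fin.suc y , there x∈S , there y∈S , eq) =
    x , y , x∈S , y∈S , trans (sym (suc-diff (toℕ x) (toℕ y))) eq
  shiftUp : ∀ {d} → InDiff S d → InDiff (outside ∷ S) d
  shiftUp (x , y , x∈S , y∈S , eq) =
    Fin.suc x , Fin.suc y , there x∈S , there y∈S , trans (suc-diff (toℕ x) (toℕ y)) eq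

signed : List ℕ → List ℤ
signed D = + 0 ∷ map +_ D ++ map (ℤ.-_ ∘ +_) D

length-signed : (D : List ℕ) → length (signed D) ≡ suc (length D + length D)
length-signed D = cong suc (trans (length-++ (map +_ D))
  (cong₂ _+_ (length-map +_ D) (length-map (ℤ.-_ ∘ +_) D)))

signed-unique : {D : List ℕ} → Unique D → All (0 ℕ.<_) D → Unique (signed D)
signed-unique {D} D! D>0 =
  AllP.++⁺ (AllP.map⁺ (All.map 0≢+ D>0)) (AllP.map⁺ (All.map 0≢-+ D>0)) ∷
  UniqueP.++⁺ (UniqueP.map⁺ ℤP.+-injective D!)
              (UniqueP.map⁺ (ℤP.+-injective ∘ ℤP.neg-injective) D!) +≢-+
  where
  0≢+ : ∀ {v} → 0 ℕ.< v → + 0 ≢ + v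
  0≢+ v>0 eq = ℕP.<⇒≢ v>0 (ℤP.+-injective eq)
  0≢-+ : ∀ {v} → 0 ℕ.< v → + 0 ≢ ℤ.- + v
  0≢-+ {suc _} _ ()
  +≢-+ : ∀ {z} → ¬ (z ∈ map +_ D × z ∈ map (ℤ.-_ ∘ +_) D)
  +≢-+ (+v∈ , -w∈) with ∈-map⁻ +_ +v∈ | ∈-map⁻ (ℤ.-_ ∘ +_) -w∈
  ... | _ , _ , refl | w , w∈D , eq with All.lookup D>0 w∈D
  ... | s≤s _ with eq
  ... | ()

diffSize≡1+2∣D∣ : {S : Subset n} {x : Fin n} {D : List ℕ} → x ∈ₛ S → Unique D →
  (∀ {v} → v ∈ D → 0 ℕ.< v × InDiff S (+ v)) →
  (∀ {v} → 0 ℕ.< v → InDiff S (+ v) → v ∈ D) →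
  diffSize S ≡ suc (length D + length D)
diffSize≡1+2∣D∣ {S = S} {x} {D} x∈S D! sound complete = trans
  (length-≡-⊆⊇ (differences-unique S) (signed-unique D! (All.tabulate (proj₁ ∘ sound)))
    (signed-complete ∘ ∈-differences⁻) (∈-differences⁺ ∘ signed-sound))
  (length-signed D)
  where
  signed-sound : ∀ {d} → d ∈ signed D → InDiff S d
  signed-sound (here refl) = InDiff-zero x∈S
  signed-sound (there d∈) with ∈-++⁻ (map +_ D) d∈
  ... | inj₁ +v∈ with ∈-map⁻ +_ +v∈
  ...   | v , v∈D , refl = proj₂ (sound v∈D)
  signed-sound (there d∈) | inj₂ -v∈ with ∈-map⁻ (ℤ.-_ ∘ +_) -v∈
  ...   | v , v∈D , refl = InDiff-neg (proj₂ (sound v∈D))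
  signed-complete : ∀ {d} → InDiff S d → d ∈ signed D
  signed-complete {+ zero}    _       = here refl
  signed-complete {+ suc k}   d∈S-S   =
    there (∈-++⁺ˡ (∈-map⁺ +_ (complete (s≤s z≤n) d∈S-S)))
  signed-complete { -[1+ k ]} d∈S-S =
    there (∈-++⁺ʳ (map +_ D) (∈-map⁺ (ℤ.-_ ∘ +_) (complete (s≤s z≤n) (InDiff-neg d∈S-S))))

-- Subsets as lists of naturals

record Enumerates (L : List ℕ) (S : Subset n) : Set where
  field
    sound    : ∀ {m} → m ∈ L → ∃[ i ] i ∈ₛ S × toℕ i ≡ m
    complete : ∀ {i} → i ∈ₛ S → toℕ i ∈ L

open Enumerates

enumerates-[] : Enumerates [] []
enumerates-[] = record { sound = λ () ; complete = λ { {()} } }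

module _ {L : List ℕ} {S : Subset n} (E : Enumerates L S) where

  private
    sound-suc : ∀ {b m} → m ∈ map suc L → ∃[ i ] i ∈ₛ (b ∷ S) × toℕ i ≡ m
    sound-suc m∈ with ∈-map⁻ suc m∈
    ... | m , m∈L , refl with sound E m∈L
    ...   | i , i∈S , refl = Fin.suc i , there i∈S , refl

  enumerates-outside : Enumerates (map suc L) (outside ∷ S)
  enumerates-outside = record
    { sound = sound-suc
    ; complete = λ { {Fin.suc i} (there i∈S) → ∈-map⁺ suc (complete E i∈S) } }

  enumerates-inside : Enumerates (0 ∷ map suc L) (inside ∷ S)
  enumerates-inside = record
    { sound = λ { (here refl) → Fin.zero , here , refl ; (there m∈) → sound-suc m∈ }
    ; complete = λ { {Fin.zero} here → here refl
                   ; {Fin.suc i} (there i∈S) → there (∈-map⁺ suc (complete E i∈S)) } }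

enumerates-injective : {L : List ℕ} {S T : Subset n} → Enumerates L S → Enumerates L T → S ≡ T
enumerates-injective E F = ⊆-antisym (E⊆F E F) (E⊆F F E)
  where
  E⊆F : ∀ {L S T} → Enumerates L S → Enumerates L T → ∀ {i} → i ∈ₛ S → i ∈ₛ T
  E⊆F {T = T} E F i∈S with sound F (complete E i∈S)
  ... | j , j∈T , toℕj≡toℕi = subst (_∈ₛ T) (FinP.toℕ-injective toℕj≡toℕi) j∈T

enumerates-⊆ : {L₁ L₂ : List ℕ} {S : Subset n} → Enumerates L₁ S → Enumerates L₂ S → L₁ ⊆ L₂
enumerates-⊆ E₁ E₂ m∈L₁ with sound E₁ m∈L₁
... | i , i∈S , refl = complete E₂ i∈S

fromList : (n : ℕ) → List ℕ → Subset n
fromList n L = tabulate (λ i → does (toℕ i ∈? L))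

∈-fromList⁺ : {L : List ℕ} {i : Fin n} → toℕ i ∈ L → i ∈ₛ fromList n L
∈-fromList⁺ {L = L} {i} i∈L =
  lookup⇒[]= i _ (trans (lookup∘tabulate _ i) (dec-true (toℕ i ∈? L) i∈L))

∈-fromList⁻ : {L : List ℕ} {i : Fin n} → i ∈ₛ fromList n L → toℕ i ∈ L
∈-fromList⁻ {L = L} {i} i∈ = decided (trans (sym (lookup∘tabulate _ i)) ([]=⇒lookup i∈))
  where
  decided : does (toℕ i ∈? L) ≡ true → toℕ i ∈ L
  decided with toℕ i ∈? L
  ... | yes i∈L = λ _ → i∈L
  ... | no _    = λ ()

enumerates-fromList : {L : List ℕ} → All (ℕ._< n) L → Enumerates L (fromList n L)
enumerates-fromList L<n = record { sound = sound′ ; complete = ∈-fromList⁻ }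
  where
  sound′ : ∀ {m} → m ∈ _ → ∃[ i ] i ∈ₛ _ × toℕ i ≡ m
  sound′ m∈L = fromℕ< m<n , ∈-fromList⁺ (subst (_∈ _) (sym (FinP.toℕ-fromℕ< m<n)) m∈L) ,
               FinP.toℕ-fromℕ< m<n
    where m<n = All.lookup L<n m∈L

fromGaps : ℕ → List ℕ → List ℕ
fromGaps x []       = x ∷ []
fromGaps x (g ∷ gs) = x ∷ fromGaps (x + g) gs

map-suc-fromGaps : ∀ x gs → map suc (fromGaps x gs) ≡ fromGaps (suc x) gs
map-suc-fromGaps x []       = refl
map-suc-fromGaps x (g ∷ gs) = cong (suc x ∷_) (map-suc-fromGaps (x + g) gs)

mutual
  gapForm : (S : Subset n) →
    Enumerates [] S ⊎ ∃₂ λ x gs → All (0 ℕ.<_) gs × Enumerates (fromGaps x gs) S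
  gapForm []           = inj₁ enumerates-[]
  gapForm (inside ∷ S)  = inj₂ (0 , gapForm-inside S)
  gapForm (outside ∷ S) with gapForm S
  ... | inj₁ E = inj₁ (enumerates-outside E)
  ... | inj₂ (x , gs , gs>0 , E) =
    inj₂ (suc x , gs , gs>0 ,
          subst (λ L → Enumerates L (outside ∷ S)) (map-suc-fromGaps x gs) (enumerates-outside E))

  gapForm-inside : (S : Subset n) →
    ∃[ gs ] All (0 ℕ.<_) gs × Enumerates (fromGaps 0 gs) (inside ∷ S)
  gapForm-inside S with gapForm S
  ... | inj₁ E = [] , [] , enumerates-inside E
  ... | inj₂ (x , gs , gs>0 , E) = suc x ∷ gs , s≤s z≤n ∷ gs>0 ,
    subst (λ L → Enumerates L (inside ∷ S)) (cong (0 ∷_) (map-suc-fromGaps x gs))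
      (enumerates-inside E)

-- Gap sequences and their run sums

runSums : List ℕ → List ℕ
runSums []       = []
runSums (g ∷ gs) = fromGaps g gs ++ runSums gs

fromGaps-+ : ∀ x y gs → fromGaps (x + y) gs ≡ map (_+_ x) (fromGaps y gs)
fromGaps-+ x y []       = refl
fromGaps-+ x y (g ∷ gs) = cong (x + y ∷_)
  (trans (cong (λ z → fromGaps z gs) (ℕP.+-assoc x y g)) (fromGaps-+ x (y + g) gs))

x∈fromGaps : ∀ x gs → x ∈ fromGaps x gs
x∈fromGaps x []      = here refl
x∈fromGaps x (_ ∷ _) = here refl

fromGaps-≥ : ∀ x gs {b} → b ∈ fromGaps x gs → x ≤ b
fromGaps-≥ x []       (here refl) = ℕP.≤-refl
fromGaps-≥ x (g ∷ gs) (here refl) = ℕP.≤-refl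
fromGaps-≥ x (g ∷ gs) (there b∈)  = ℕP.≤-trans (ℕP.m≤m+n x g) (fromGaps-≥ (x + g) gs b∈)

fromGaps-≤ : ∀ x gs {b} → b ∈ fromGaps x gs → b ≤ x + sum gs
fromGaps-≤ x []       (here refl) = ℕP.m≤m+n x 0
fromGaps-≤ x (g ∷ gs) (here refl) = ℕP.m≤m+n x (sum (g ∷ gs))
fromGaps-≤ x (g ∷ gs) (there b∈)  =
  ℕP.≤-trans (fromGaps-≤ (x + g) gs b∈) (ℕP.≤-reflexive (ℕP.+-assoc x g (sum gs)))

last∈fromGaps : ∀ x gs → x + sum gs ∈ fromGaps x gs
last∈fromGaps x []       = here (ℕP.+-identityʳ x)
last∈fromGaps x (g ∷ gs) =
  there (subst (_∈ fromGaps (x + g) gs) (ℕP.+-assoc x g (sum gs)) (last∈fromGaps (x + g) gs))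

length-fromGaps : ∀ x gs → length (fromGaps x gs) ≡ suc (length gs)
length-fromGaps x []       = refl
length-fromGaps x (g ∷ gs) = cong suc (length-fromGaps (x + g) gs)

fromGaps-unique : ∀ x {gs} → All (0 ℕ.<_) gs → Unique (fromGaps x gs)
fromGaps-unique x {[]}     []           = [] ∷ []
fromGaps-unique x {g ∷ gs} (g>0 ∷ gs>0) =
  All.tabulate (λ b∈ → ℕP.<⇒≢ (ℕP.<-≤-trans (ℕP.m<m+n x g>0) (fromGaps-≥ (x + g) gs b∈))) ∷
  fromGaps-unique (x + g) gs>0

fromGaps-⊆-tail : ∀ {x g g′ c c′} → 0 ℕ.< g → fromGaps x (g ∷ c) ⊆ fromGaps x (g′ ∷ c′) →
  fromGaps (x + g) c ⊆ fromGaps (x + g′) c′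
fromGaps-⊆-tail {x} {g} {c = c} g>0 c₁⊆c₂ b∈ with c₁⊆c₂ (there b∈)
... | here refl = ⊥-elim (ℕP.<⇒≢ (ℕP.<-≤-trans (ℕP.m<m+n x g>0) (fromGaps-≥ (x + g) c b∈)) refl)
... | there b∈′ = b∈′

fromGaps-⊆-first : ∀ {x g g′ c c′} → 0 ℕ.< g → fromGaps x (g ∷ c) ⊆ fromGaps x (g′ ∷ c′) → g′ ≤ g
fromGaps-⊆-first {x} {g} {g′} {c} {c′} g>0 c₁⊆c₂ = ℕP.+-cancelˡ-≤ x g′ g
  (fromGaps-≥ (x + g′) c′ (fromGaps-⊆-tail g>0 c₁⊆c₂ (x∈fromGaps (x + g) c)))

fromGaps-⊈-[] : ∀ {x g c} → 0 ℕ.< g → ¬ (fromGaps x (g ∷ c) ⊆ fromGaps x [])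
fromGaps-⊈-[] {x} {g} {c} g>0 c⊆[] with c⊆[] (there (x∈fromGaps (x + g) c))
... | here x+g≡x = ℕP.<⇒≢ (ℕP.m<m+n x g>0) (sym x+g≡x)

fromGaps-injective : ∀ x {c₁ c₂} → All (0 ℕ.<_) c₁ → All (0 ℕ.<_) c₂ →
  fromGaps x c₁ ⊆ fromGaps x c₂ → fromGaps x c₂ ⊆ fromGaps x c₁ → c₁ ≡ c₂
fromGaps-injective x {[]}    {[]}    _          _          _ _ = refl
fromGaps-injective x {[]}    {_ ∷ _} _          (g>0 ∷ _) _ c₂⊆c₁ = ⊥-elim (fromGaps-⊈-[] g>0 c₂⊆c₁)
fromGaps-injective x {_ ∷ _} {[]}    (g>0 ∷ _) _          c₁⊆c₂ _ = ⊥-elim (fromGaps-⊈-[] g>0 c₁⊆c₂)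
fromGaps-injective x {g ∷ c₁} {_ ∷ c₂} (g>0 ∷ c₁>0) (g′>0 ∷ c₂>0) c₁⊆c₂ c₂⊆c₁
  with ℕP.≤-antisym (fromGaps-⊆-first g′>0 c₂⊆c₁) (fromGaps-⊆-first g>0 c₁⊆c₂)
... | refl = cong (g ∷_)
  (fromGaps-injective (x + g) c₁>0 c₂>0 (fromGaps-⊆-tail g>0 c₁⊆c₂) (fromGaps-⊆-tail g′>0 c₂⊆c₁))

runSums-positive : ∀ {gs} → All (0 ℕ.<_) gs → All (0 ℕ.<_) (runSums gs)
runSums-positive {[]}     []            = []
runSums-positive {g ∷ gs} (g>0 ∷ gs>0) = AllP.++⁺
  (All.tabulate (λ v∈ → ℕP.<-≤-trans g>0 (fromGaps-≥ g gs v∈))) (runSums-positive gs>0)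

runSums-sound : ∀ x gs {v} → v ∈ runSums gs →
  ∃₂ λ a b → a ∈ fromGaps x gs × b ∈ fromGaps x gs × a + v ≡ b
runSums-sound x (g ∷ gs) v∈ with ∈-++⁻ (fromGaps g gs) v∈
... | inj₁ v∈run = x , x + _ , here refl ,
  there (subst (_ ∈_) (sym (fromGaps-+ x g gs)) (∈-map⁺ (_+_ x) v∈run)) , refl
... | inj₂ v∈rest with runSums-sound (x + g) gs v∈rest
...   | a , b , a∈ , b∈ , a+v≡b = a , b , there a∈ , there b∈ , a+v≡b

runSums-complete : ∀ x gs {a b v} → a ∈ fromGaps x gs → b ∈ fromGaps x gs →
  a + v ≡ b → 0 ℕ.< v → v ∈ runSums gs
runSums-complete x []       (here refl) (here refl) x+v≡x v>0 =
  ⊥-elim (ℕP.<⇒≢ (ℕP.m<m+n x v>0) (sym x+v≡x))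
runSums-complete x (g ∷ gs) (here refl) (here refl) x+v≡x v>0 =
  ⊥-elim (ℕP.<⇒≢ (ℕP.m<m+n x v>0) (sym x+v≡x))
runSums-complete x (g ∷ gs) {v = v} (here refl) (there b∈) x+v≡b _
  with ∈-map⁻ (_+_ x) (subst (_ ∈_) (fromGaps-+ x g gs) b∈)
... | w , w∈ , refl = ∈-++⁺ˡ (subst (_∈ fromGaps g gs) (sym (ℕP.+-cancelˡ-≡ x v w x+v≡b)) w∈)
runSums-complete x (g ∷ gs) {a} (there a∈) (here refl) a+v≡x v>0 =
  ⊥-elim (ℕP.<⇒≢ (ℕP.≤-<-trans (ℕP.≤-trans (ℕP.m≤m+n x g) (fromGaps-≥ (x + g) gs a∈))
                                (ℕP.m<m+n a v>0)) (sym a+v≡x))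
runSums-complete x (g ∷ gs) (there a∈) (there b∈) a+v≡b v>0 =
  ∈-++⁺ʳ (fromGaps g gs) (runSums-complete (x + g) gs a∈ b∈ a+v≡b v>0)

spread : List ℕ → ℕ
spread gs = length (deduplicate _≟_ (runSums gs))

diffSize-fromGaps : ∀ {x gs} {S : Subset n} → All (0 ℕ.<_) gs → Enumerates (fromGaps x gs) S →
  diffSize S ≡ suc (spread gs + spread gs)
diffSize-fromGaps {x = x} {gs} gs>0 E with sound E (x∈fromGaps x gs)
... | i , i∈S , _ = diffSize≡1+2∣D∣ i∈S (deduplicate-! (runSums gs)) sound′ complete′
  where
  sound′ : ∀ {v} → v ∈ deduplicate _≟_ (runSums gs) → 0 ℕ.< v × InDiff _ (+ v)
  sound′ v∈ with ∈-deduplicate⁻ _≟_ (runSums gs) v∈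
  ... | v∈runs with runSums-sound x gs v∈runs
  ...   | a , b , a∈ , b∈ , a+v≡b with sound E a∈ | sound E b∈
  ...     | j , j∈S , refl | k , k∈S , refl =
    All.lookup (runSums-positive gs>0) v∈runs , k , j , k∈S , j∈S , n+o≡m⇒[+m]-[+n]≡+o a+v≡b
  complete′ : ∀ {v} → 0 ℕ.< v → InDiff _ (+ v) → v ∈ deduplicate _≟_ (runSums gs)
  complete′ v>0 (j , k , j∈S , k∈S , j-k≡v) = ∈-deduplicate⁺ _≟_
    (runSums-complete x gs (complete E k∈S) (complete E j∈S) ([+m]-[+n]≡+o⇒n+o≡m j-k≡v) v>0)

spread-≤ : ∀ {gs Q} → All (_∈ Q) (runSums gs) → spread gs ≤ length Q
spread-≤ {gs} runs⊆Q =
  length-≤-⊆ (deduplicate-! (runSums gs)) (All.lookup runs⊆Q ∘ ∈-deduplicate⁻ _≟_ (runSums gs))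

≤-spread : ∀ {gs Q} → Unique Q → Q ⊆ runSums gs → length Q ≤ spread gs
≤-spread Q! Q⊆runs = length-≤-⊆ Q! (∈-deduplicate⁺ _≟_ ∘ Q⊆runs)

spread≡ : ∀ {gs Q} → Unique Q → Q ⊑ runSums gs → All (_∈ Q) (runSums gs) → spread gs ≡ length Q
spread≡ {gs} Q! Q⊑runs runs⊆Q =
  ℕP.≤-antisym (spread-≤ {gs} runs⊆Q) (≤-spread {gs} Q! (Sublist.lookup Q⊑runs))

-- Gap sequences with four distinct run sums

unique₅ : ∀ {a b c d e : ℕ} → a ≢ b → a ≢ c → a ≢ d → a ≢ e → b ≢ c → b ≢ d → b ≢ e →
  c ≢ d → c ≢ e → d ≢ e → Unique (a ∷ b ∷ c ∷ d ∷ e ∷ [])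
unique₅ ab ac ad ae bc bd be cd ce de =
  (ab ∷ ac ∷ ad ∷ ae ∷ []) ∷ (bc ∷ bd ∷ be ∷ []) ∷ (cd ∷ ce ∷ []) ∷ (de ∷ []) ∷ [] ∷ []

pos+ : ∀ {m} n → 0 ℕ.< m → 0 ℕ.< m + n
pos+ n m>0 = ℕP.<-≤-trans m>0 (ℕP.m≤m+n _ n)

spread≢4-≤3 : ∀ {gs Q} → All (_∈ Q) (runSums gs) → length Q ≤ 3 → spread gs ≢ 4
spread≢4-≤3 {gs} runs⊆Q |Q|≤3 spread≡4 =
  ℕP.<-irrefl spread≡4 (ℕP.≤-<-trans (spread-≤ {gs} runs⊆Q) (s≤s |Q|≤3))

spread≢4-≥5 : ∀ {gs Q} → Unique Q → Q ⊆ runSums gs → 5 ≤ length Q → spread gs ≢ 4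
spread≢4-≥5 {gs} Q! Q⊆runs 5≤|Q| spread≡4 =
  ℕP.<-irrefl (sym spread≡4) (ℕP.≤-trans 5≤|Q| (≤-spread {gs} Q! Q⊆runs))

-- The gap sequences of {0,p,p+q,2p+q}, {0,t,2t,4t}, {0,2t,3t,4t} and {0,t,2t,3t,4t}.
data Spread₄ : List ℕ → Set where
  palindrome   : ∀ p q → 0 ℕ.< p → 0 ℕ.< q → q ≢ p → Spread₄ (p ∷ q ∷ p ∷ [])
  doubledLast  : ∀ t → 0 ℕ.< t → Spread₄ (t ∷ t ∷ t + t ∷ [])
  doubledFirst : ∀ t → 0 ℕ.< t → Spread₄ (t + t ∷ t ∷ t ∷ [])
  progression  : ∀ t → 0 ℕ.< t → Spread₄ (t ∷ t ∷ t ∷ t ∷ [])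

ppr-runs-unique : ∀ {p r} → 0 ℕ.< p → 0 ℕ.< r → p ≢ r → r ≢ p + p →
  Unique (p ∷ p + p ∷ p + p + r ∷ p + r ∷ r ∷ [])
ppr-runs-unique {p} {r} p>0 r>0 p≢r r≢2p = unique₅ (ℕP.<⇒≢ (ℕP.m<m+n p p>0))
  (ℕP.<⇒≢ (ℕP.<-≤-trans (ℕP.m<m+n p p>0) (ℕP.m≤m+n (p + p) r)))
  (ℕP.<⇒≢ (ℕP.m<m+n p r>0)) p≢r (ℕP.<⇒≢ (ℕP.m<m+n (p + p) r>0))
  (p≢r ∘ ℕP.+-cancelˡ-≡ p p r) (r≢2p ∘ sym)
  (ℕP.>⇒≢ (ℕP.+-monoˡ-< r (ℕP.m<n+m p p>0))) (ℕP.>⇒≢ (ℕP.m<n+m r (pos+ p p>0)))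
  (ℕP.>⇒≢ (ℕP.m<n+m r p>0))

sumFirst-runs-unique : ∀ {x y} → 0 ℕ.< x → 0 ℕ.< y → x ≢ y →
  Unique (x + y ∷ x + y + x ∷ x + y + x + y ∷ x ∷ y ∷ [])
sumFirst-runs-unique {x} {y} x>0 y>0 x≢y = unique₅ (ℕP.<⇒≢ (ℕP.m<m+n (x + y) x>0))
  (ℕP.<⇒≢ (ℕP.<-≤-trans (ℕP.m<m+n (x + y) x>0) (ℕP.m≤m+n (x + y + x) y)))
  (ℕP.>⇒≢ (ℕP.m<m+n x y>0)) (ℕP.>⇒≢ (ℕP.m<n+m y x>0))
  (ℕP.<⇒≢ (ℕP.m<m+n (x + y + x) y>0)) (ℕP.>⇒≢ (ℕP.m<n+m x x+y>0))
  (ℕP.>⇒≢ (ℕP.<-≤-trans (ℕP.m<n+m y x>0) (ℕP.m≤m+n (x + y) x)))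
  (ℕP.>⇒≢ (ℕP.<-≤-trans (ℕP.m<n+m x x+y>0) (ℕP.m≤m+n (x + y + x) y)))
  (ℕP.>⇒≢ (ℕP.m<n+m y (pos+ x x+y>0)))
  x≢y
  where x+y>0 = pos+ y x>0

spread₄-ppr : ∀ p r → 0 ℕ.< p → 0 ℕ.< r → p ≢ r →
  spread (p ∷ p ∷ r ∷ []) ≡ 4 → Spread₄ (p ∷ p ∷ r ∷ [])
spread₄-ppr p r p>0 r>0 p≢r s≡4 with r ≟ p + p
... | yes refl = doubledLast p p>0
... | no r≢2p  = ⊥-elim (spread≢4-≥5 {p ∷ p ∷ r ∷ []} (ppr-runs-unique p>0 r>0 p≢r r≢2p)
  (Sublist.lookup (refl ∷ refl ∷ refl ∷ p ∷ʳ refl ∷ refl ∷ [])) ℕP.≤-refl s≡4)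

spread₄-pqq : ∀ p q → 0 ℕ.< p → 0 ℕ.< q → p ≢ q →
  spread (p ∷ q ∷ q ∷ []) ≡ 4 → Spread₄ (p ∷ q ∷ q ∷ [])
spread₄-pqq p q p>0 q>0 p≢q s≡4 with p ≟ q + q
... | yes refl = doubledFirst q q>0
... | no p≢2q  = ⊥-elim (spread≢4-≥5 {p ∷ q ∷ q ∷ []} Q!
  (Sublist.lookup (refl ∷ refl ∷ refl ∷ refl ∷ refl ∷ q ∷ʳ [])) ℕP.≤-refl s≡4)
  where
  Q! : Unique (p ∷ p + q ∷ p + q + q ∷ q ∷ q + q ∷ [])
  Q! = unique₅ (ℕP.<⇒≢ (ℕP.m<m+n p q>0))
    (ℕP.<⇒≢ (ℕP.<-≤-trans (ℕP.m<m+n p q>0) (ℕP.m≤m+n (p + q) q))) p≢q p≢2q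
    (ℕP.<⇒≢ (ℕP.m<m+n (p + q) q>0)) (ℕP.>⇒≢ (ℕP.m<n+m q p>0)) (p≢q ∘ ℕP.+-cancelʳ-≡ q p q)
    (ℕP.>⇒≢ (ℕP.m<n+m q (pos+ q p>0))) (ℕP.>⇒≢ (ℕP.+-monoˡ-< q (ℕP.m<n+m q p>0)))
    (ℕP.<⇒≢ (ℕP.m<m+n q q>0))

spread≢4-distinct : ∀ p q r → 0 ℕ.< p → 0 ℕ.< q → 0 ℕ.< r → p ≢ q → p ≢ r → q ≢ r →
  spread (p ∷ q ∷ r ∷ []) ≢ 4
spread≢4-distinct p q r p>0 q>0 r>0 p≢q p≢r q≢r with p ≟ q + r
... | no p≢q+r = spread≢4-≥5 {p ∷ q ∷ r ∷ []} Q!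
  (Sublist.lookup (refl ∷ refl ∷ refl ∷ refl ∷ refl ∷ r ∷ʳ [])) ℕP.≤-refl
  where
  Q! : Unique (p ∷ p + q ∷ p + q + r ∷ q ∷ q + r ∷ [])
  Q! = unique₅ (ℕP.<⇒≢ (ℕP.m<m+n p q>0))
    (ℕP.<⇒≢ (ℕP.<-≤-trans (ℕP.m<m+n p q>0) (ℕP.m≤m+n (p + q) r))) p≢q p≢q+r
    (ℕP.<⇒≢ (ℕP.m<m+n (p + q) r>0)) (ℕP.>⇒≢ (ℕP.m<n+m q p>0))
    (λ eq → p≢r (ℕP.+-cancelʳ-≡ q p r (trans eq (ℕP.+-comm q r))))
    (ℕP.>⇒≢ (ℕP.<-≤-trans (ℕP.m<n+m q p>0) (ℕP.m≤m+n (p + q) r)))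
    (ℕP.>⇒≢ (ℕP.+-monoˡ-< r (ℕP.m<n+m q p>0)))
    (ℕP.<⇒≢ (ℕP.m<m+n q r>0))
... | yes refl = spread≢4-≥5 {q + r ∷ q ∷ r ∷ []} (sumFirst-runs-unique q>0 r>0 q≢r)
  (Sublist.lookup (refl ∷ refl ∷ refl ∷ refl ∷ (q + r) ∷ʳ refl ∷ [])) ℕP.≤-refl

spread₄-three : ∀ p q r → 0 ℕ.< p → 0 ℕ.< q → 0 ℕ.< r →
  spread (p ∷ q ∷ r ∷ []) ≡ 4 → Spread₄ (p ∷ q ∷ r ∷ [])
spread₄-three p q r p>0 q>0 r>0 s≡4 with p ≟ r | p ≟ q | q ≟ r
... | yes refl | yes refl | _ = ⊥-elim (spread≢4-≤3 {p ∷ p ∷ p ∷ []} {p ∷ p + p ∷ p + p + p ∷ []}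
  (here refl ∷ there (here refl) ∷ there (there (here refl)) ∷ here refl ∷ there (here refl) ∷
   here refl ∷ []) ℕP.≤-refl s≡4)
... | yes refl | no p≢q   | _        = palindrome p q p>0 q>0 (p≢q ∘ sym)
... | no p≢r   | yes refl | _        = spread₄-ppr p r p>0 r>0 p≢r s≡4
... | no p≢r   | no p≢q   | yes refl = spread₄-pqq p q p>0 q>0 p≢q s≡4
... | no p≢r   | no p≢q   | no q≢r   = ⊥-elim (spread≢4-distinct p q r p>0 q>0 r>0 p≢q p≢r q≢r s≡4)

spread₄-four : ∀ p q r s → 0 ℕ.< p → 0 ℕ.< q → 0 ℕ.< r → 0 ℕ.< s →
  spread (p ∷ q ∷ r ∷ s ∷ []) ≡ 4 → Spread₄ (p ∷ q ∷ r ∷ s ∷ [])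
spread₄-four p q r s p>0 q>0 r>0 s>0 s≡4 with p ≟ q | r ≟ s
... | no p≢q | _ = ⊥-elim (spread≢4-≥5 {p ∷ q ∷ r ∷ s ∷ []} Q!
  (Sublist.lookup (refl ∷ refl ∷ refl ∷ refl ∷ refl ∷ minimum _)) ℕP.≤-refl s≡4)
  where
  a<b = ℕP.m<m+n p q>0
  b<c = ℕP.m<m+n (p + q) r>0
  c<d = ℕP.m<m+n (p + q + r) s>0
  e<b = ℕP.m<n+m q p>0
  Q! : Unique (p ∷ p + q ∷ p + q + r ∷ p + q + r + s ∷ q ∷ [])
  Q! = unique₅ (ℕP.<⇒≢ a<b) (ℕP.<⇒≢ (ℕP.<-trans a<b b<c))
    (ℕP.<⇒≢ (ℕP.<-trans a<b (ℕP.<-trans b<c c<d))) p≢q (ℕP.<⇒≢ b<c)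
    (ℕP.<⇒≢ (ℕP.<-trans b<c c<d)) (ℕP.>⇒≢ e<b) (ℕP.<⇒≢ c<d) (ℕP.>⇒≢ (ℕP.<-trans e<b b<c))
    (ℕP.>⇒≢ (ℕP.<-trans e<b (ℕP.<-trans b<c c<d)))
... | yes refl | no r≢s = ⊥-elim (spread≢4-≥5 {p ∷ p ∷ r ∷ s ∷ []} Q!
  (Sublist.lookup (p ∷ʳ (p + p) ∷ʳ (p + p + r) ∷ʳ refl ∷ p ∷ʳ (p + r) ∷ʳ
                   refl ∷ refl ∷ refl ∷ refl ∷ [])) ℕP.≤-refl s≡4)
  where
  b<a = ℕP.+-monoˡ-< s (ℕP.+-monoˡ-< r (ℕP.m<n+m p p>0))
  d<b = ℕP.+-monoˡ-< s (ℕP.m<n+m r p>0)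
  c<d = ℕP.m<m+n r s>0
  e<d = ℕP.m<n+m s r>0
  Q! : Unique (p + p + r + s ∷ p + r + s ∷ r ∷ r + s ∷ s ∷ [])
  Q! = unique₅ (ℕP.>⇒≢ b<a) (ℕP.>⇒≢ (ℕP.<-trans c<d (ℕP.<-trans d<b b<a)))
    (ℕP.>⇒≢ (ℕP.<-trans d<b b<a)) (ℕP.>⇒≢ (ℕP.<-trans e<d (ℕP.<-trans d<b b<a)))
    (ℕP.>⇒≢ (ℕP.<-trans c<d d<b)) (ℕP.>⇒≢ d<b) (ℕP.>⇒≢ (ℕP.<-trans e<d d<b))
    (ℕP.<⇒≢ c<d) r≢s (ℕP.>⇒≢ e<d)
... | yes refl | yes refl with p ≟ r
...   | yes refl = progression p p>0
...   | no p≢r   = ⊥-elim (spread≢4-≥5 {p ∷ p ∷ r ∷ r ∷ []} Q!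
  (Sublist.lookup (refl ∷ refl ∷ refl ∷ refl ∷ p ∷ʳ refl ∷ minimum _)) ℕP.≤-refl s≡4)
  where
  a<b = ℕP.m<m+n p p>0
  b<c = ℕP.m<m+n (p + p) r>0
  c<d = ℕP.m<m+n (p + p + r) r>0
  a<e = ℕP.m<m+n p r>0
  e<c = ℕP.+-monoˡ-< r (ℕP.m<n+m p p>0)
  Q! : Unique (p ∷ p + p ∷ p + p + r ∷ p + p + r + r ∷ p + r ∷ [])
  Q! = unique₅ (ℕP.<⇒≢ a<b) (ℕP.<⇒≢ (ℕP.<-trans a<b b<c))
    (ℕP.<⇒≢ (ℕP.<-trans a<b (ℕP.<-trans b<c c<d))) (ℕP.<⇒≢ a<e) (ℕP.<⇒≢ b<c)
    (ℕP.<⇒≢ (ℕP.<-trans b<c c<d)) (p≢r ∘ ℕP.+-cancelˡ-≡ p p r) (ℕP.<⇒≢ c<d)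
    (ℕP.>⇒≢ e<c) (ℕP.>⇒≢ (ℕP.<-trans e<c c<d))

spread₄ : ∀ gs → All (0 ℕ.<_) gs → spread gs ≡ 4 → Spread₄ gs
spread₄ []          _ ()
spread₄ (_ ∷ [])    _ ()
spread₄ (p ∷ q ∷ []) _ s≡4 =
  ⊥-elim (spread≢4-≤3 {p ∷ q ∷ []} {runSums (p ∷ q ∷ [])} (All.tabulate (λ v∈ → v∈)) ℕP.≤-refl s≡4)
spread₄ (p ∷ q ∷ r ∷ []) (p>0 ∷ q>0 ∷ r>0 ∷ []) = spread₄-three p q r p>0 q>0 r>0
spread₄ (p ∷ q ∷ r ∷ s ∷ []) (p>0 ∷ q>0 ∷ r>0 ∷ s>0 ∷ []) = spread₄-four p q r s p>0 q>0 r>0 s>0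
spread₄ (g ∷ gs@(_ ∷ _ ∷ _ ∷ _ ∷ _)) (_ ∷ gs>0) s≡4 =
  ⊥-elim (spread≢4-≥5 {g ∷ gs} (fromGaps-unique g gs>0) ∈-++⁺ˡ
    (subst (5 ≤_) (sym (length-fromGaps g gs)) (s≤s (s≤s (s≤s (s≤s (s≤s z≤n)))))) s≡4)

-- Sets containing 0, and recoding those with nine differences

∈-allSubsets : (S : Subset n) → S ∈ allSubsets n
∈-allSubsets []            = here refl
∈-allSubsets {suc n} (outside ∷ S) = ∈-++⁺ˡ (∈-map⁺ (outside ∷_) (∈-allSubsets S))
∈-allSubsets {suc n} (inside ∷ S)  =
  ∈-++⁺ʳ (map (outside ∷_) (allSubsets n)) (∈-map⁺ (inside ∷_) (∈-allSubsets S))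

allSubsets-unique : ∀ n → Unique (allSubsets n)
allSubsets-unique zero    = [] ∷ []
allSubsets-unique (suc n) = UniqueP.++⁺ (UniqueP.map⁺ ∷-injectiveʳ (allSubsets-unique n))
  (UniqueP.map⁺ ∷-injectiveʳ (allSubsets-unique n)) outside≢inside
  where
  outside≢inside : ∀ {T} →
    ¬ (T ∈ map (outside ∷_) (allSubsets n) × T ∈ map (inside ∷_) (allSubsets n))
  outside≢inside (T∈₁ , T∈₂) with ∈-map⁻ (outside ∷_) T∈₁ | ∈-map⁻ (inside ∷_) T∈₂
  ... | _ , _ , refl | _ , _ , ()

withZero : (n : ℕ) → List (Subset (suc n))
withZero n = map (inside ∷_) (allSubsets n)

ofDiffSize : ℕ → List (Subset n) → List (Subset n)
ofDiffSize k = filter (λ S → diffSize S ≟ k)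

zero∈⇒∈withZero : {T : Subset (suc n)} → Fin.zero ∈ₛ T → T ∈ withZero n
zero∈⇒∈withZero {T = inside ∷ T} here = ∈-map⁺ (inside ∷_) (∈-allSubsets T)

ofDiffSize-outside : ∀ k (Ss : List (Subset n)) →
  length (ofDiffSize k (map (outside ∷_) Ss)) ≡ length (ofDiffSize k Ss)
ofDiffSize-outside k = length-filter-map (λ S → diffSize S ≟ k) (λ S → diffSize S ≟ k) (outside ∷_)
  (λ {S} → trans (sym (diffSize-outside S))) (λ {S} → trans (diffSize-outside S))

count-suc : ∀ n k → count (suc n) k ≡ count n k + length (ofDiffSize k (withZero n))
count-suc n k = begin
  length (ofDiffSize k (map (outside ∷_) Ss ++ withZero n))
    ≡⟨ cong length (filter-++ (λ S → diffSize S ≟ k) (map (outside ∷_) Ss) (withZero n)) ⟩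
  length (ofDiffSize k (map (outside ∷_) Ss) ++ ofDiffSize k (withZero n))
    ≡⟨ length-++ (ofDiffSize k (map (outside ∷_) Ss)) ⟩
  length (ofDiffSize k (map (outside ∷_) Ss)) + length (ofDiffSize k (withZero n))
    ≡⟨ cong (_+ length (ofDiffSize k (withZero n))) (ofDiffSize-outside k Ss) ⟩
  count n k + length (ofDiffSize k (withZero n)) ∎
  where
  open ≡-Reasoning
  Ss = allSubsets n

double-injective : ∀ {m n} → m + m ≡ n + n → m ≡ n
double-injective {zero}  {zero}  _  = refl
double-injective {suc m} {suc n} eq = cong suc (double-injective
  (ℕP.suc-injective (trans (sym (ℕP.+-suc m m)) (trans (ℕP.suc-injective eq) (ℕP.+-suc n n)))))

record Spread₄Form (S : Subset n) : Set where
  field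
    gaps          : List ℕ
    enumerates    : Enumerates (fromGaps 0 gaps) S
    shape         : Spread₄ gaps

spread₄Form : {S : Subset (suc n)} → S ∈ ofDiffSize 9 (withZero n) → Spread₄Form S
spread₄Form {n} S∈ with ∈-filter⁻ (λ S → diffSize S ≟ 9) {xs = withZero n} S∈
... | S∈withZero , diffSize≡9 with ∈-map⁻ (inside ∷_) S∈withZero
...   | S′ , _ , refl with gapForm-inside S′
...     | gs , gs>0 , E = record
  { gaps = gs ; enumerates = E
  ; shape = spread₄ gs gs>0
      (double-injective (ℕP.suc-injective (trans (sym (diffSize-fromGaps gs>0 E)) diffSize≡9))) }

record Recoding (k : ℕ) : Set where
  field
    code          : ∀ {gs} → Spread₄ gs → List ℕ
    decode        : List ℕ → List ℕ
    decode-code   : ∀ {gs} (s : Spread₄ gs) → decode (code s) ≡ gs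
    code-positive : ∀ {gs} (s : Spread₄ gs) → All (0 ℕ.<_) (code s)
    code-spread   : ∀ {gs} (s : Spread₄ gs) → spread (code s) ≡ k
    -- The slack ⊔ 5 is needed: no set of diameter 4 has five distinct positive differences.
    code-sum      : ∀ {gs} (s : Spread₄ gs) → sum (code s) ≤ sum gs ⊔ 5

module _ {k} (R : Recoding k) {n} (5<1+n : 5 ℕ.< suc n) where
  open Recoding R
  open Spread₄Form

  private
    Nines = ofDiffSize 9 (withZero n)

    recodedElements : ∀ {S} → S ∈ Nines → List ℕ
    recodedElements S∈ = fromGaps 0 (code (shape (spread₄Form S∈)))

    recoded : ∀ {S} → S ∈ Nines → Subset (suc n)
    recoded S∈ = fromList (suc n) (recodedElements S∈)

    recodedElements-bounded : ∀ {S} (S∈ : S ∈ Nines) → All (ℕ._< suc n) (recodedElements S∈)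
    recodedElements-bounded S∈ = All.tabulate λ b∈ →
      ℕP.≤-<-trans (ℕP.≤-trans (fromGaps-≤ 0 _ b∈) (code-sum (shape F))) (ℕP.⊔-lub sum<1+n 5<1+n)
      where
      F = spread₄Form S∈
      sum<1+n : sum (gaps F) ℕ.< suc n
      sum<1+n with sound (enumerates F) (last∈fromGaps 0 (gaps F))
      ... | i , _ , toℕi≡sum = subst (ℕ._< suc n) toℕi≡sum (FinP.toℕ<n i)

    recoded-enumerates : ∀ {S} (S∈ : S ∈ Nines) → Enumerates (recodedElements S∈) (recoded S∈)
    recoded-enumerates S∈ = enumerates-fromList (recodedElements-bounded S∈)

    recoded-∈ : ∀ {S} (S∈ : S ∈ Nines) → recoded S∈ ∈ ofDiffSize (suc (k + k)) (withZero n)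
    recoded-∈ S∈ = ∈-filter⁺ (λ S → diffSize S ≟ suc (k + k))
      (zero∈⇒∈withZero (∈-fromList⁺ {i = Fin.zero} (x∈fromGaps 0 (code s))))
      (trans (diffSize-fromGaps (code-positive s) (recoded-enumerates S∈))
             (cong (λ m → suc (m + m)) (code-spread s)))
      where s = shape (spread₄Form S∈)

    recoded-injective : ∀ {S T} (S∈ : S ∈ Nines) (T∈ : T ∈ Nines) → recoded S∈ ≡ recoded T∈ → S ≡ T
    recoded-injective {T = T} S∈ T∈ eq = enumerates-injective (enumerates F)
      (subst (λ gs → Enumerates (fromGaps 0 gs) T) (sym gaps≡) (enumerates G))
      where
      F = spread₄Form S∈
      G = spread₄Form T∈
      E₁ = recoded-enumerates S∈
      E₂ = subst (Enumerates (recodedElements T∈)) (sym eq) (recoded-enumerates T∈)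
      code≡ : code (shape F) ≡ code (shape G)
      code≡ = fromGaps-injective 0 (code-positive (shape F)) (code-positive (shape G))
        (enumerates-⊆ E₁ E₂) (enumerates-⊆ E₂ E₁)
      gaps≡ : gaps F ≡ gaps G
      gaps≡ = trans (sym (decode-code (shape F)))
        (trans (cong decode code≡) (decode-code (shape G)))

  recode-≤ : length (ofDiffSize 9 (withZero n)) ≤ length (ofDiffSize (suc (k + k)) (withZero n))
  recode-≤ = length-≤-injection
    (UniqueP.filter⁺ (λ S → diffSize S ≟ 9) (UniqueP.map⁺ ∷-injectiveʳ (allSubsets-unique n)))
    recoded recoded-∈ recoded-injective

-- Recoding into sets with seven differences

-- {0,p,p+q,2p+q} ↦ {0,p,2p+q}, {0,t,2t,4t} ↦ {0,t,3t}, {0,2t,3t,4t} ↦ {0,2t,3t} and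
-- {0,t,…,4t} ↦ {0,3t,4t}: the four families of images are told apart by which gap is larger
-- and whether one gap is twice the other.
code₃ : ∀ {gs} → Spread₄ gs → List ℕ
code₃ (palindrome p q _ _ _) = p ∷ q + p ∷ []
code₃ (doubledLast t _)      = t ∷ t + t ∷ []
code₃ (doubledFirst t _)     = t + t ∷ t ∷ []
code₃ (progression t _)      = t + t + t ∷ t ∷ []

decode₃-rising : ℕ → ℕ → List ℕ
decode₃-rising a b with b ≟ a + a
... | yes _ = a ∷ a ∷ a + a ∷ []
... | no _  = a ∷ b ∸ a ∷ a ∷ []

decode₃-falling : ℕ → ℕ → List ℕ
decode₃-falling a b with a ≟ b + b
... | yes _ = b + b ∷ b ∷ b ∷ []
... | no _  = b ∷ b ∷ b ∷ b ∷ []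

decode₃ : List ℕ → List ℕ
decode₃ (a ∷ b ∷ []) with a ℕ.<? b
... | yes _ = decode₃-rising a b
... | no _  = decode₃-falling a b
decode₃ _ = []

spread-pair : ∀ {x y} → 0 ℕ.< x → 0 ℕ.< y → x ≢ y → spread (x ∷ y ∷ []) ≡ 3
spread-pair {x} {y} x>0 y>0 x≢y = spread≡ {x ∷ y ∷ []}
  ((ℕP.<⇒≢ (ℕP.m<m+n x y>0) ∷ x≢y ∷ []) ∷ (ℕP.>⇒≢ (ℕP.m<n+m y x>0) ∷ []) ∷ [] ∷ [])
  Sublist.⊆-refl (All.tabulate (λ v∈ → v∈))

recoding₃ : Recoding 3
recoding₃ = record
  { code = code₃ ; decode = decode₃ ; decode-code = decode-code
  ; code-positive = positive ; code-spread = spread₃ ; code-sum = λ s → ℕP.m≤n⇒m≤n⊔o 5 (sum≤ s) }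
  where
  decode-code : ∀ {gs} (s : Spread₄ gs) → decode₃ (code₃ s) ≡ gs
  decode-code (palindrome p q p>0 q>0 q≢p) with p ℕ.<? q + p
  ... | no p≮q+p = ⊥-elim (p≮q+p (ℕP.m<n+m p q>0))
  ... | yes _ with q + p ≟ p + p
  ...   | yes q+p≡2p = ⊥-elim (q≢p (ℕP.+-cancelʳ-≡ p q p q+p≡2p))
  ...   | no _       = cong (λ z → p ∷ z ∷ p ∷ []) (ℕP.m+n∸n≡m q p)
  decode-code (doubledLast t t>0) with t ℕ.<? t + t
  ... | no t≮2t = ⊥-elim (t≮2t (ℕP.m<m+n t t>0))
  ... | yes _ with t + t ≟ t + t
  ...   | yes _   = refl
  ...   | no 2t≢2t = ⊥-elim (2t≢2t refl)
  decode-code (doubledFirst t t>0) with t + t ℕ.<? t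
  ... | yes 2t<t = ⊥-elim (ℕP.<⇒≱ 2t<t (ℕP.m≤m+n t t))
  ... | no _ with t + t ≟ t + t
  ...   | yes _   = refl
  ...   | no 2t≢2t = ⊥-elim (2t≢2t refl)
  decode-code (progression t t>0) with t + t + t ℕ.<? t
  ... | yes 3t<t = ⊥-elim (ℕP.<⇒≱ 3t<t (ℕP.≤-trans (ℕP.m≤m+n t t) (ℕP.m≤m+n (t + t) t)))
  ... | no _ with t + t + t ≟ t + t
  ...   | yes 3t≡2t = ⊥-elim (ℕP.>⇒≢ (ℕP.m<m+n (t + t) t>0) 3t≡2t)
  ...   | no _      = refl
  positive : ∀ {gs} (s : Spread₄ gs) → All (0 ℕ.<_) (code₃ s)
  positive (palindrome p q p>0 q>0 _) = p>0 ∷ pos+ p q>0 ∷ []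
  positive (doubledLast t t>0)        = t>0 ∷ pos+ t t>0 ∷ []
  positive (doubledFirst t t>0)       = pos+ t t>0 ∷ t>0 ∷ []
  positive (progression t t>0)        = pos+ t (pos+ t t>0) ∷ t>0 ∷ []
  spread₃ : ∀ {gs} (s : Spread₄ gs) → spread (code₃ s) ≡ 3
  spread₃ (palindrome p q p>0 q>0 _) = spread-pair p>0 (pos+ p q>0) (ℕP.<⇒≢ (ℕP.m<n+m p q>0))
  spread₃ (doubledLast t t>0)  = spread-pair t>0 (pos+ t t>0) (ℕP.<⇒≢ (ℕP.m<m+n t t>0))
  spread₃ (doubledFirst t t>0) = spread-pair (pos+ t t>0) t>0 (ℕP.>⇒≢ (ℕP.m<m+n t t>0))
  spread₃ (progression t t>0)  =
    spread-pair (pos+ t (pos+ t t>0)) t>0 (ℕP.>⇒≢ (ℕP.m<n+m t (pos+ t t>0)))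
  sum≤ : ∀ {gs} (s : Spread₄ gs) → sum (code₃ s) ≤ sum gs
  sum≤ (palindrome p q _ _ _) = ℕP.≤-reflexive (cong (_+_ p) (ℕP.+-assoc q p 0))
  sum≤ (doubledLast t _)      = ℕP.+-monoʳ-≤ t (ℕP.m≤n+m _ t)
  sum≤ (doubledFirst t _)     = ℕP.+-monoʳ-≤ (t + t) (ℕP.m≤n+m _ t)
  sum≤ (progression t _)      =
    ℕP.≤-reflexive (trans (ℕP.+-assoc (t + t) t (t + 0)) (ℕP.+-assoc t t (t + (t + 0))))

-- Recoding into sets with eleven differences

sumFirst sumLast : ℕ → ℕ → List ℕ
sumFirst x y = x + y ∷ x ∷ y ∷ []
sumLast  x y = x ∷ y ∷ x + y ∷ []

-- (p,q,p) ↦ (p,p,q) when q ≠ 2p. The other sources have diameter 4t (t = p for (p,2p,p)) and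
-- go to (x+y,x,y) or (x,y,x+y) with {x,y} = {t-1,t+1}; the order of x and y records the family
-- of the source. For t = 1 four fixed sets of diameter 5 are used.
code₅-palindrome : ∀ p → 0 ℕ.< p → List ℕ
code₅-palindrome (suc zero)    _ = 1 ∷ 1 ∷ 1 ∷ 2 ∷ []
code₅-palindrome (suc (suc u)) _ = sumFirst (3 + u) (suc u)

code₅ : ∀ {gs} → Spread₄ gs → List ℕ
code₅ (palindrome p q p>0 _ _) with q ≟ p + p
... | no _  = p ∷ p ∷ q ∷ []
... | yes _ = code₅-palindrome p p>0
code₅ (doubledLast  (suc zero)    _) = 2 ∷ 1 ∷ 1 ∷ 1 ∷ []
code₅ (doubledLast  (suc (suc u)) _) = sumFirst (suc u) (3 + u)
code₅ (doubledFirst (suc zero)    _) = 1 ∷ 1 ∷ 2 ∷ 1 ∷ []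
code₅ (doubledFirst (suc (suc u)) _) = sumLast (3 + u) (suc u)
code₅ (progression  (suc zero)    _) = 1 ∷ 2 ∷ 1 ∷ 1 ∷ []
code₅ (progression  (suc (suc u)) _) = sumLast (suc u) (3 + u)

decode₅-sumFirst : ℕ → ℕ → List ℕ
decode₅-sumFirst x y with x ℕ.≤? y
... | yes _ = suc x ∷ suc x ∷ suc x + suc x ∷ []
... | no _  = suc y ∷ suc y + suc y ∷ suc y ∷ []

decode₅-sumLast : ℕ → ℕ → List ℕ
decode₅-sumLast x y with y ℕ.≤? x
... | yes _ = suc y + suc y ∷ suc y ∷ suc y ∷ []
... | no _  = suc x ∷ suc x ∷ suc x ∷ suc x ∷ []

decode₅ : List ℕ → List ℕ
decode₅ (a ∷ b ∷ c ∷ []) with a ≟ b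
... | yes _ = a ∷ c ∷ a ∷ []
... | no _ with a ≟ b + c
...   | yes _ = decode₅-sumFirst b c
...   | no _  = decode₅-sumLast a b
decode₅ (1 ∷ 1 ∷ 1 ∷ 2 ∷ []) = 1 ∷ 2 ∷ 1 ∷ []
decode₅ (2 ∷ 1 ∷ 1 ∷ 1 ∷ []) = 1 ∷ 1 ∷ 2 ∷ []
decode₅ (1 ∷ 1 ∷ 2 ∷ 1 ∷ []) = 2 ∷ 1 ∷ 1 ∷ []
decode₅ (1 ∷ 2 ∷ 1 ∷ 1 ∷ []) = 1 ∷ 1 ∷ 1 ∷ 1 ∷ []
decode₅ _ = []

spread-ppr : ∀ {p r} → 0 ℕ.< p → 0 ℕ.< r → p ≢ r → r ≢ p + p → spread (p ∷ p ∷ r ∷ []) ≡ 5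
spread-ppr {p} {r} p>0 r>0 p≢r r≢2p = spread≡ {p ∷ p ∷ r ∷ []} (ppr-runs-unique p>0 r>0 p≢r r≢2p)
  (refl ∷ refl ∷ refl ∷ p ∷ʳ refl ∷ refl ∷ [])
  (here refl ∷ there (here refl) ∷ there (there (here refl)) ∷ here refl ∷
   there (there (there (here refl))) ∷ there (there (there (there (here refl)))) ∷ [])

spread-sumFirst : ∀ {x y} → 0 ℕ.< x → 0 ℕ.< y → x ≢ y → spread (sumFirst x y) ≡ 5
spread-sumFirst {x} {y} x>0 y>0 x≢y = spread≡ {sumFirst x y} (sumFirst-runs-unique x>0 y>0 x≢y)
  (refl ∷ refl ∷ refl ∷ refl ∷ (x + y) ∷ʳ refl ∷ [])
  (here refl ∷ there (here refl) ∷ there (there (here refl)) ∷ there (there (there (here refl))) ∷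
   here refl ∷ there (there (there (there (here refl)))) ∷ [])

spread-sumLast : ∀ {x y} → 0 ℕ.< x → 0 ℕ.< y → x ≢ y → spread (sumLast x y) ≡ 5
spread-sumLast {x} {y} x>0 y>0 x≢y = spread≡ {sumLast x y}
  (unique₅ (ℕP.<⇒≢ a<b) (ℕP.<⇒≢ (ℕP.<-trans a<b b<c)) x≢y (ℕP.<⇒≢ (ℕP.<-trans a<b b<e))
    (ℕP.<⇒≢ b<c) (ℕP.>⇒≢ d<b) (ℕP.<⇒≢ b<e) (ℕP.>⇒≢ (ℕP.<-trans d<b b<c)) (ℕP.>⇒≢ e<c)
    (ℕP.<⇒≢ (ℕP.m<m+n y (pos+ y x>0))))
  (refl ∷ refl ∷ refl ∷ refl ∷ refl ∷ (x + y) ∷ʳ [])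
  (here refl ∷ there (here refl) ∷ there (there (here refl)) ∷ there (there (there (here refl))) ∷
   there (there (there (there (here refl)))) ∷ there (here refl) ∷ [])
  where
  a<b = ℕP.m<m+n x y>0
  b<c = ℕP.m<m+n (x + y) (pos+ y x>0)
  d<b = ℕP.m<n+m y x>0
  b<e = ℕP.m<n+m (x + y) y>0
  e<c = ℕP.+-monoˡ-< (x + y) d<b

decode₅-sumFirst-code : ∀ x y → 0 ℕ.< y → decode₅ (sumFirst x y) ≡ decode₅-sumFirst x y
decode₅-sumFirst-code x y y>0 with x + y ≟ x
... | yes x+y≡x = ⊥-elim (ℕP.>⇒≢ (ℕP.m<m+n x y>0) x+y≡x)
... | no _ with x + y ≟ x + y
...   | yes _ = refl
...   | no x+y≢x+y = ⊥-elim (x+y≢x+y refl)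

decode₅-sumLast-code : ∀ x y → 0 ℕ.< x → 0 ℕ.< y → x ≢ y →
  decode₅ (sumLast x y) ≡ decode₅-sumLast x y
decode₅-sumLast-code x y x>0 y>0 x≢y with x ≟ y
... | yes x≡y = ⊥-elim (x≢y x≡y)
... | no _ with x ≟ y + (x + y)
...   | yes x≡y+x+y = ⊥-elim (ℕP.<⇒≢ (ℕP.<-≤-trans (ℕP.m<m+n x y>0) (ℕP.m≤n+m (x + y) y)) x≡y+x+y)
...   | no _ = refl

decode₅-palindrome : ∀ p (p>0 : 0 ℕ.< p) → decode₅ (code₅-palindrome p p>0) ≡ p ∷ p + p ∷ p ∷ []
decode₅-palindrome (suc zero)    _ = refl
decode₅-palindrome (suc (suc u)) _ rewrite decode₅-sumFirst-code (3 + u) (suc u) (s≤s z≤n)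
  with 3 + u ℕ.≤? suc u
... | yes 3+u≤1+u = ⊥-elim (ℕP.<⇒≱ (ℕP.m<n+m (suc u) {2} (s≤s z≤n)) 3+u≤1+u)
... | no _ = refl

recoding₅ : Recoding 5
recoding₅ = record
  { code = code₅ ; decode = decode₅ ; decode-code = decode-code
  ; code-positive = positive ; code-spread = spread₅ ; code-sum = sum≤ }
  where
  1+u>0 : ∀ {u} → 0 ℕ.< suc u
  1+u>0 = s≤s z≤n
  1+u≢3+u : ∀ {u} → suc u ≢ 3 + u
  1+u≢3+u {u} = ℕP.<⇒≢ (ℕP.m<n+m (suc u) {2} 1+u>0)
  3+u≢1+u : ∀ {u} → 3 + u ≢ suc u
  3+u≢1+u = 1+u≢3+u ∘ sym

  decode-code : ∀ {gs} (s : Spread₄ gs) → decode₅ (code₅ s) ≡ gs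
  decode-code (palindrome p q p>0 _ q≢p) with q ≟ p + p
  ... | yes refl = decode₅-palindrome p p>0
  ... | no _ with p ≟ p
  ...   | yes _   = refl
  ...   | no p≢p  = ⊥-elim (p≢p refl)
  decode-code (doubledLast (suc zero) _) = refl
  decode-code (doubledLast (suc (suc u)) _)
    rewrite decode₅-sumFirst-code (suc u) (3 + u) 1+u>0 with suc u ℕ.≤? 3 + u
  ... | yes _  = refl
  ... | no 1+u≰3+u = ⊥-elim (1+u≰3+u (ℕP.m≤n+m (suc u) 2))
  decode-code (doubledFirst (suc zero) _) = refl
  decode-code (doubledFirst (suc (suc u)) _)
    rewrite decode₅-sumLast-code (3 + u) (suc u) 1+u>0 1+u>0 3+u≢1+u with suc u ℕ.≤? 3 + u
  ... | yes _  = refl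
  ... | no 1+u≰3+u = ⊥-elim (1+u≰3+u (ℕP.m≤n+m (suc u) 2))
  decode-code (progression (suc zero) _) = refl
  decode-code (progression (suc (suc u)) _)
    rewrite decode₅-sumLast-code (suc u) (3 + u) 1+u>0 1+u>0 1+u≢3+u with 3 + u ℕ.≤? suc u
  ... | yes 3+u≤1+u = ⊥-elim (ℕP.<⇒≱ (ℕP.m<n+m (suc u) {2} 1+u>0) 3+u≤1+u)
  ... | no _ = refl

  positive : ∀ {gs} (s : Spread₄ gs) → All (0 ℕ.<_) (code₅ s)
  positive (palindrome p q p>0 q>0 _) with q ≟ p + p
  positive (palindrome (suc zero)    _ _ _ _) | yes _ = 1+u>0 ∷ 1+u>0 ∷ 1+u>0 ∷ 1+u>0 ∷ []
  positive (palindrome (suc (suc u)) _ _ _ _) | yes _ = 1+u>0 ∷ 1+u>0 ∷ 1+u>0 ∷ []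
  ... | no _ = p>0 ∷ p>0 ∷ q>0 ∷ []
  positive (doubledLast  (suc zero)    _) = 1+u>0 ∷ 1+u>0 ∷ 1+u>0 ∷ 1+u>0 ∷ []
  positive (doubledLast  (suc (suc u)) _) = 1+u>0 ∷ 1+u>0 ∷ 1+u>0 ∷ []
  positive (doubledFirst (suc zero)    _) = 1+u>0 ∷ 1+u>0 ∷ 1+u>0 ∷ 1+u>0 ∷ []
  positive (doubledFirst (suc (suc u)) _) = 1+u>0 ∷ 1+u>0 ∷ 1+u>0 ∷ []
  positive (progression  (suc zero)    _) = 1+u>0 ∷ 1+u>0 ∷ 1+u>0 ∷ 1+u>0 ∷ []
  positive (progression  (suc (suc u)) _) = 1+u>0 ∷ 1+u>0 ∷ 1+u>0 ∷ []

  spread₅ : ∀ {gs} (s : Spread₄ gs) → spread (code₅ s) ≡ 5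
  spread₅ (palindrome p q p>0 q>0 q≢p) with q ≟ p + p
  spread₅ (palindrome (suc zero)    _ _ _ _) | yes _ = refl
  spread₅ (palindrome (suc (suc u)) _ _ _ _) | yes _ =
    spread-sumFirst {3 + u} {suc u} 1+u>0 1+u>0 3+u≢1+u
  ... | no q≢2p = spread-ppr p>0 q>0 (q≢p ∘ sym) q≢2p
  spread₅ (doubledLast  (suc zero)    _) = refl
  spread₅ (doubledLast  (suc (suc u)) _) = spread-sumFirst {suc u} {3 + u} 1+u>0 1+u>0 1+u≢3+u
  spread₅ (doubledFirst (suc zero)    _) = refl
  spread₅ (doubledFirst (suc (suc u)) _) = spread-sumLast {3 + u} {suc u} 1+u>0 1+u>0 3+u≢1+u
  spread₅ (progression  (suc zero)    _) = refl
  spread₅ (progression  (suc (suc u)) _) = spread-sumLast {suc u} {3 + u} 1+u>0 1+u>0 1+u≢3+u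

  sum≤ : ∀ {gs} (s : Spread₄ gs) → sum (code₅ s) ≤ sum gs ⊔ 5
  sum≤ (palindrome p q _ _ _) with q ≟ p + p
  sum≤ (palindrome (suc zero)    _ _ _ _) | yes refl = ℕP.m≤n⊔m 5 _
  sum≤ (palindrome (suc (suc u)) _ _ _ _) | yes refl = ℕP.m≤n⇒m≤n⊔o 5 (ℕP.≤-reflexive (same u))
    where
    same : ∀ u → 3 + u + suc u + (3 + u + (suc u + 0)) ≡ 2 + u + (2 + u + (2 + u) + (2 + u + 0))
    same = solve-∀
  ... | no _ = ℕP.m≤n⇒m≤n⊔o 5 (ℕP.≤-reflexive (same p q))
    where
    same : ∀ p q → p + (p + (q + 0)) ≡ p + (q + (p + 0))
    same = solve-∀
  sum≤ (doubledLast  (suc zero)    _) = ℕP.m≤n⊔m 5 _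
  sum≤ (doubledLast  (suc (suc u)) _) = ℕP.m≤n⇒m≤n⊔o 5 (ℕP.≤-reflexive (same u))
    where
    same : ∀ u → suc u + (3 + u) + (suc u + (3 + u + 0)) ≡ 2 + u + (2 + u + (2 + u + (2 + u) + 0))
    same = solve-∀
  sum≤ (doubledFirst (suc zero)    _) = ℕP.m≤n⊔m 5 _
  sum≤ (doubledFirst (suc (suc u)) _) = ℕP.m≤n⇒m≤n⊔o 5 (ℕP.≤-reflexive (same u))
    where
    same : ∀ u → 3 + u + (suc u + (3 + u + suc u + 0)) ≡ 2 + u + (2 + u) + (2 + u + (2 + u + 0))
    same = solve-∀
  sum≤ (progression  (suc zero)    _) = ℕP.m≤n⊔m 5 _
  sum≤ (progression  (suc (suc u)) _) = ℕP.m≤n⇒m≤n⊔o 5 (ℕP.≤-reflexive (same u))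
    where
    same : ∀ u → suc u + (3 + u + (suc u + (3 + u) + 0)) ≡ 2 + u + (2 + u + (2 + u + (2 + u + 0)))
    same = solve-∀

count-9<-suc : ∀ {k} → Recoding k → ∀ {n} → 5 ℕ.< suc n →
  count n 9 ℕ.< count n (suc (k + k)) → count (suc n) 9 ℕ.< count (suc n) (suc (k + k))
count-9<-suc {k} R {n} 5<1+n count-9< =
  subst₂ ℕ._<_ (sym (count-suc n 9)) (sym (count-suc n (suc (k + k))))
    (ℕP.+-mono-<-≤ count-9< (recode-≤ R 5<1+n))

count-9<-from-7 : ∀ {k} → Recoding k → count 7 9 ℕ.< count 7 (suc (k + k)) →
  ∀ d → count (7 + d) 9 ℕ.< count (7 + d) (suc (k + k))
count-9<-from-7 R base zero    = base
count-9<-from-7 R base (suc d) = count-9<-suc R (ℕP.m≤m+n 6 (2 + d)) (count-9<-from-7 R base d)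

-- The counts at n = 7 are 31, 17 and 25; at n = 6 the second inequality fails (10 > 9).
count-7-9<7 : count 7 9 ℕ.< count 7 7
count-7-9<7 = from-yes (count 7 9 ℕ.<? count 7 7)

count-7-9<11 : count 7 9 ℕ.< count 7 11
count-7-9<11 = from-yes (count 7 9 ℕ.<? count 7 11)

/-monoˡ-< : ∀ {a b} d .{{_ : ℕ.NonZero d}} → a ℕ.< b → (+ a ℚ./ d) ℚ.< (+ b ℚ./ d)
/-monoˡ-< {a} {b} (suc k) a<b = ℚP.toℚᵘ-cancel-<
  (ℚᵘP.<-respʳ-≃ (ℚᵘP.≃-sym (ℚP.toℚᵘ-fromℚᵘ (ℚᵘ.mkℚᵘ (+ b) k)))
  (ℚᵘP.<-respˡ-≃ (ℚᵘP.≃-sym (ℚP.toℚᵘ-fromℚᵘ (ℚᵘ.mkℚᵘ (+ a) k)))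
   (ℚᵘ.*<* (ℤP.*-monoʳ-<-pos (+ suc k) (ℤ.+<+ a<b)))))

P-mono : ∀ n {a b} → count n a ℕ.< count n b → P n a < P n b
P-mono n = /-monoˡ-< (2 ^ n) {{ℕ.>-nonZero (ℕP.m^n>0 2 n)}}

proposition2p3 : (n : ℕ) → n ≥ 7 → (P n 7 > P n 9) × (P n 9 < P n 11)
proposition2p3 n n≥7 =
  P-mono n (subst (λ m → count m 9 ℕ.< count m 7) n≡7+d (count-9<-from-7 recoding₃ count-7-9<7 d)) ,
  P-mono n (subst (λ m → count m 9 ℕ.< count m 11) n≡7+d (count-9<-from-7 recoding₅ count-7-9<11 d))
  where
  d = n ∸ 7
  n≡7+d = ℕP.m+[n∸m]≡n n≥7
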